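{- Let $X,Y$ be directed graphs with $V(X)=V(Y)=[n]$, and let $a\to b$ be an edge of $X$. Let $X'$ be the directed graph with vertex set $[n]$ and edge set $E(X')=E(X)\setminus\{a\to b\}$. Then \[ \mathrm{ODP}(X',Y)=\mathrm{ODP}(X,Y)-\left(\frac{x-1}{x}\right)\mathrm{ODP}(X,Y)_{a\to b}. \]
   Context: Directed graphs are finite, without loops or multiple edges, and no two vertices are joined by edges in both directions. For directed graphs $X,Y$ on vertex set $[n]$, $\mathrm{DFS}(X,Y)$ is the directed graph whose vertices are the permutations $\sigma$ of $[n]$ (viewed as bijections $V(X)\to V(Y)$), with a directed edge from $\sigma$ to $\sigma\circ(a\;b)$ whenever $a\ne b$, $a\to b$ is an edge of $X$ and $\sigma(a)\to\sigma(b)$ is an edge of $Y$ (here $\sigma\circ(a\;b)$ agrees with $\sigma$ except that it sends $a$ to $\sigma(b)$ and $b$ to $\sigma(a)$). $\mathrm{ODP}(X,Y)=\sum_{\sigma} x^{\mathrm{outdeg}(\sigma)}$, summing over all vertices of $\mathrm{DFS}(X,Y)$. For vertices $a,b$, $\mathrm{ODP}(X,Y)_{a\to b}$ is the sum of $x^{\mathrm{outdeg}(\sigma)}$ over those permutations $\sigma$ for which $\sigma(a)\to\sigma(b)$ is an edge of $Y$. -}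

module Defs where

open import Data.Bool using (Bool; true; false; _∧_; _∨_; not; if_then_else_)
open import Data.Nat using (ℕ; zero; suc)
open import Data.Fin using (Fin)
open import Data.Fin.Properties using (_≟_)
open import Data.List using (List; []; _∷_; map; concatMap; filterᵇ; length; foldr; allFin)
open import Data.Bool.ListAction using (all; any)
open import Data.Vec using (Vec; []; _∷_; lookup; tabulate)
import Data.Vec.Properties as VecP
open import Data.Rational using (ℚ; 0ℚ; 1ℚ; _+_; _*_)
open import Relation.Binary.PropositionalEquality using (_≡_)
open import Relation.Nullary.Decidable using (⌊_⌋)

Rel : ℕ → Set
Rel n = Fin n → Fin n → Bool

record IsDigraph {n : ℕ} (E : Rel n) : Set where
  field
    loopless   : ∀ a → E a a ≡ false
    asymmetric : ∀ a b → E a b ≡ true → E b a ≡ false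

_==_ : ∀ {n} → Fin n → Fin n → Bool
i == j = ⌊ i ≟ j ⌋

deleteEdge : ∀ {n} → Rel n → Fin n → Fin n → Rel n
deleteEdge X a b i j = X i j ∧ not ((i == a) ∧ (j == b))

-- all maps Fin m → Fin n, as vectors of images
allVecs : ∀ {n} (m : ℕ) → List (Vec (Fin n) m)
allVecs zero = [] ∷ []
allVecs {n} (suc m) = concatMap (λ i → map (i ∷_) (allVecs m)) (allFin n)

isInjective : ∀ {n} → Vec (Fin n) n → Bool
isInjective {n} σ =
  all (λ i → all (λ j → not (lookup σ i == lookup σ j) ∨ (i == j)) (allFin n)) (allFin n)

-- all permutations of [n] (bijections V(X) → V(Y)), each exactly once
perms : (n : ℕ) → List (Vec (Fin n) n)
perms n = filterᵇ isInjective (allVecs n)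

transp : ∀ {n} → Fin n → Fin n → Fin n → Fin n
transp a b i = if i == a then b else (if i == b then a else i)

_∘swap_,_ : ∀ {n} → Vec (Fin n) n → Fin n → Fin n → Vec (Fin n) n
σ ∘swap a , b = tabulate (λ i → lookup σ (transp a b i))

_=ᵥ_ : ∀ {n} → Vec (Fin n) n → Vec (Fin n) n → Bool
σ =ᵥ τ = ⌊ VecP.≡-dec _≟_ σ τ ⌋

-- Is there a directed edge σ → τ in DFS(X,Y)?
dfsEdge : ∀ {n} → Rel n → Rel n → Vec (Fin n) n → Vec (Fin n) n → Bool
dfsEdge {n} X Y σ τ =
  any (λ a → any (λ b → not (a == b) ∧ X a b ∧ Y (lookup σ a) (lookup σ b)
                          ∧ (τ =ᵥ (σ ∘swap a , b))) (allFin n)) (allFin n)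

outdeg : ∀ {n} → Rel n → Rel n → Vec (Fin n) n → ℕ
outdeg {n} X Y σ = length (filterᵇ (dfsEdge X Y σ) (perms n))

_^_ : ℚ → ℕ → ℚ
x ^ zero = 1ℚ
x ^ suc k = x * (x ^ k)

sumℚ : List ℚ → ℚ
sumℚ = foldr _+_ 0ℚ

ODP : ∀ {n} → Rel n → Rel n → ℚ → ℚ
ODP {n} X Y x = sumℚ (map (λ σ → x ^ outdeg X Y σ) (perms n))

ODP[_⟶_] : ∀ {n} → Fin n → Fin n → Rel n → Rel n → ℚ → ℚ
ODP[_⟶_] {n} a b X Y x =
  sumℚ (map (λ σ → x ^ outdeg X Y σ)
            (filterᵇ (λ σ → Y (lookup σ a) (lookup σ b)) (perms n)))

{-# OPTIONS --safe #-}

-- Fix a permutation σ. The only out-edge of σ in DFS(X,Y) that deleting a → b from X can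
-- remove is σ → σ ∘ (a b), present exactly when σ(a) → σ(b) is an edge of Y; and it is removed:
-- as σ is injective, σ ∘ (i j) = σ ∘ (a b) forces {i,j} = {a,b}, and b → a is not an edge of X.
-- So outdeg drops by one exactly on the permutations counted by ODP(X,Y)_{a→b}, and
-- x^d = x^(d+1) − ((x − 1)/x)·x^(d+1).

module Submission where

open import Defs
open import Data.Bool using (Bool; true; false; T; not; _∧_; _∨_; if_then_else_)
open import Data.Bool.ListAction using (all)
open import Data.Bool.Properties using (T-∧; T-∨)
open import Data.Empty using (⊥-elim)
open import Data.Fin using (Fin)
open import Data.Fin.Properties using (_≟_)
open import Data.List using (List; []; _∷_; map; filterᵇ; length; allFin)
open import Data.List.Properties using (filter-accept; filter-reject; filter-none; map-cong-local)
open import Data.List.Membership.Propositional using (_∈_; lose)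
open import Data.List.Membership.Propositional.Properties
  using (∈-allFin; ∈-map⁺; ∈-map⁻; ∈-concatMap⁺; ∈-filter⁺; ∈-filter⁻)
open import Data.List.Relation.Unary.All as All using (All; [])
open import Data.List.Relation.Unary.All.Properties using (all⁺; all⁻) renaming (map⁺ to All-map⁺)
open import Data.List.Relation.Unary.Any using (here; there; satisfied)
open import Data.List.Relation.Unary.Any.Properties using (any⁺; any⁻)
open import Data.List.Relation.Unary.AllPairs as AllPairs using ([]; _∷_)
import Data.List.Relation.Unary.AllPairs.Properties as AllPairs
open import Data.List.Relation.Unary.Unique.Propositional using (Unique)
import Data.List.Relation.Unary.Unique.Propositional.Properties as Unique
open import Data.List.Relation.Binary.Disjoint.Propositional using (Disjoint)
open import Data.Nat using (ℕ; zero; suc)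
import Data.Nat as Nat
open import Data.Nat.Properties using (+-suc)
open import Data.Product using (_×_; _,_; proj₁; proj₂)
open import Data.Rational using (ℚ; 0ℚ; 1ℚ; _+_; _*_; _-_; 1/_; NonZero)
import Data.Rational.Properties as ℚ
open import Data.Rational.Solver using (module +-*-Solver)
open import Data.Sum as Sum using (_⊎_; inj₁; inj₂)
open import Data.Vec using (Vec; []; _∷_; lookup)
import Data.Vec.Properties as Vec
open import Function using (_∘_)
open import Function.Bundles using (_⇔_; mk⇔; Equivalence)
open import Function.Definitions using (Injective)
open import Relation.Binary.Definitions using (DecidableEquality)
open import Relation.Binary.PropositionalEquality
  using (_≡_; _≢_; refl; sym; trans; cong; subst; module ≡-Reasoning)
open import Relation.Nullary using (¬_; yes; no; _×-dec_)
open import Relation.Nullary.Decidable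
  using (⌊_⌋; T?; toWitness; fromWitness; toWitnessFalse; fromWitnessFalse)

open Equivalence using (to; from)

T-injective : ∀ {x y} → (T x ⇔ T y) → x ≡ y
T-injective {false} {false} _   = refl
T-injective {false} {true}  x⇔y = ⊥-elim (from x⇔y _)
T-injective {true}  {false} x⇔y = ⊥-elim (to x⇔y _)
T-injective {true}  {true}  _   = refl

module _ {A : Set} where

  count : (A → Bool) → List A → ℕ
  count p xs = length (filterᵇ p xs)

  count-none : ∀ {p : A → Bool} {xs} → All (λ x → ¬ T (p x)) xs → count p xs ≡ 0
  count-none {p} none = cong length (filter-none (T? ∘ p) none)

  count-cong : ∀ {p q : A → Bool} → (∀ x → p x ≡ q x) → ∀ xs → count p xs ≡ count q xs
  count-cong p≗q []       = refl
  count-cong {q = q} p≗q (x ∷ xs) rewrite p≗q x with q x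
  ... | true  = cong suc (count-cong p≗q xs)
  ... | false = count-cong p≗q xs

  count-∨ : ∀ {p q : A → Bool} → (∀ x → T (p x) → ¬ T (q x)) → ∀ xs →
            count (λ x → p x ∨ q x) xs ≡ count p xs Nat.+ count q xs
  count-∨ disjoint [] = refl
  count-∨ {p} {q} disjoint (x ∷ xs) with p x | q x | disjoint x
  ... | true  | true  | px⇒¬qx = ⊥-elim (px⇒¬qx _ _)
  ... | true  | false | _ = cong suc (count-∨ disjoint xs)
  ... | false | true  | _ = trans (cong suc (count-∨ disjoint xs)) (sym (+-suc _ _))
  ... | false | false | _ = count-∨ disjoint xs

  count-∧ˡ : ∀ c {p : A → Bool} xs → count (λ x → c ∧ p x) xs ≡ (if c then count p xs else 0)
  count-∧ˡ true  xs = refl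
  count-∧ˡ false xs = count-none (All.universal (λ _ ()) xs)

  module _ (_≟ᴬ_ : DecidableEquality A) (v : A) where

    private
      is-v : A → Bool
      is-v w = ⌊ w ≟ᴬ v ⌋

    count-≟-unique : ∀ {xs} → Unique xs → v ∈ xs → count (λ w → ⌊ w ≟ᴬ v ⌋) xs ≡ 1
    count-≟-unique {x ∷ xs} (x≢xs ∷ _) (here refl) =
      trans (cong length (filter-accept (T? ∘ is-v) {x} {xs} (fromWitness refl)))
            (cong suc (count-none (All.map (λ x≢w w≡v → x≢w (sym (toWitness w≡v))) x≢xs)))
    count-≟-unique {x ∷ xs} (x≢xs ∷ xs!) (there v∈xs) =
      trans (cong length (filter-reject (T? ∘ is-v) {x} {xs} (All.lookup x≢xs v∈xs ∘ toWitness)))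
            (count-≟-unique xs! v∈xs)

module _ {n : ℕ} where

  ∈-allVecs : ∀ {m} (v : Vec (Fin n) m) → v ∈ allVecs m
  ∈-allVecs []      = here refl
  ∈-allVecs {suc m} (h ∷ t) =
    ∈-concatMap⁺ (λ i → map (i ∷_) (allVecs m)) (lose (∈-allFin h) (∈-map⁺ (h ∷_) (∈-allVecs t)))

  allVecs-unique : ∀ m → Unique (allVecs {n} m)
  allVecs-unique zero    = [] ∷ []
  allVecs-unique (suc m) =
    Unique.concat⁺ (All-map⁺ (All.universal prefixed-unique (allFin n)))
                   (AllPairs.map⁺ (AllPairs.map prefixed-disjoint (Unique.allFin⁺ n)))
    where
    prefixed-unique : ∀ i → Unique (map (i ∷_) (allVecs m))
    prefixed-unique i = Unique.map⁺ Vec.∷-injectiveʳ (allVecs-unique m)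

    prefixed-disjoint : ∀ {i j} → i ≢ j → Disjoint (map (i ∷_) (allVecs m)) (map (j ∷_) (allVecs m))
    prefixed-disjoint i≢j (v∈ᵢ , v∈ⱼ) with ∈-map⁻ (_ ∷_) v∈ᵢ | ∈-map⁻ (_ ∷_) v∈ⱼ
    ... | _ , _ , refl | _ , _ , v≡j∷ = i≢j (Vec.∷-injectiveˡ v≡j∷)

Injectiveᵥ : ∀ {n} → Vec (Fin n) n → Set
Injectiveᵥ σ = Injective _≡_ _≡_ (lookup σ)

isInjective-reflects : ∀ {n} (σ : Vec (Fin n) n) → T (isInjective σ) ⇔ Injectiveᵥ σ
isInjective-reflects {n} σ = mk⇔ sound complete
  where
  test : Fin n → Fin n → Bool
  test i j = not (lookup σ i == lookup σ j) ∨ (i == j)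

  test-passes : T (isInjective σ) → ∀ i j → T (test i j)
  test-passes t i j =
    All.lookup (all⁺ (test i) (allFin n) (All.lookup (all⁺ _ (allFin n) t) (∈-allFin i))) (∈-allFin j)

  sound : T (isInjective σ) → Injectiveᵥ σ
  sound t {i} {j} σi≡σj with lookup σ i ≟ lookup σ j | test-passes t i j
  ... | yes _    | i≡j = toWitness i≡j
  ... | no σi≢σj | _   = ⊥-elim (σi≢σj σi≡σj)

  complete : Injectiveᵥ σ → T (isInjective σ)
  complete inj =
    all⁻ _ (All.universal (λ i → all⁻ (test i) (All.universal (inj⇒test i) (allFin n))) (allFin n))
    where
    inj⇒test : ∀ i j → T (test i j)
    inj⇒test i j with lookup σ i ≟ lookup σ j
    ... | yes σi≡σj = fromWitness (inj σi≡σj)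
    ... | no _      = _

perms-unique : ∀ n → Unique (perms n)
perms-unique n = Unique.filter⁺ (T? ∘ isInjective) (allVecs-unique n)

∈-perms⁺ : ∀ {n} {σ : Vec (Fin n) n} → Injectiveᵥ σ → σ ∈ perms n
∈-perms⁺ {σ = σ} σ-inj =
  ∈-filter⁺ (T? ∘ isInjective) (∈-allVecs σ) (from (isInjective-reflects σ) σ-inj)

∈-perms⁻ : ∀ {n} {σ : Vec (Fin n) n} → σ ∈ perms n → Injectiveᵥ σ
∈-perms⁻ {n} {σ} σ∈ =
  to (isInjective-reflects σ) (proj₂ (∈-filter⁻ (T? ∘ isInjective) {xs = allVecs n} σ∈))

count-=ᵥ-perms : ∀ {n} {v : Vec (Fin n) n} → Injectiveᵥ v → count (_=ᵥ v) (perms n) ≡ 1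
count-=ᵥ-perms {n} {v} v-inj =
  count-≟-unique (Vec.≡-dec _≟_) v (perms-unique n) (∈-perms⁺ v-inj)

module _ {n : ℕ} (a b : Fin n) where

  transp-left : transp a b a ≡ b
  transp-left with a ≟ a
  ... | yes _   = refl
  ... | no a≢a = ⊥-elim (a≢a refl)

  transp-right : transp a b b ≡ a
  transp-right with b ≟ a
  ... | yes b≡a = b≡a
  ... | no _ with b ≟ b
  ...   | yes _   = refl
  ...   | no b≢b = ⊥-elim (b≢b refl)

  transp-cases : ∀ i → (i ≡ a × transp a b i ≡ b) ⊎ (i ≡ b × transp a b i ≡ a) ⊎ transp a b i ≡ i
  transp-cases i with i ≟ a | i ≟ b
  ... | yes refl | _        = inj₁ (refl , refl)
  ... | no _     | yes refl = inj₂ (inj₁ (refl , refl))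
  ... | no _     | no _     = inj₂ (inj₂ refl)

  transp-involutive : ∀ i → transp a b (transp a b i) ≡ i
  transp-involutive i with transp-cases i
  ... | inj₁ (refl , τa≡b)        = trans (cong (transp a b) τa≡b) transp-right
  ... | inj₂ (inj₁ (refl , τb≡a)) = trans (cong (transp a b) τb≡a) transp-left
  ... | inj₂ (inj₂ τi≡i)          = trans (cong (transp a b) τi≡i) τi≡i

  transp-injective : Injective _≡_ _≡_ (transp a b)
  transp-injective {i} {j} eq =
    trans (sym (transp-involutive i)) (trans (cong (transp a b) eq) (transp-involutive j))

  lookup-∘swap : ∀ (σ : Vec (Fin n) n) i → lookup (σ ∘swap a , b) i ≡ lookup σ (transp a b i)
  lookup-∘swap σ = Vec.lookup∘tabulate (lookup σ ∘ transp a b)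

  ∘swap-injective : ∀ (σ : Vec (Fin n) n) → Injectiveᵥ σ → Injectiveᵥ (σ ∘swap a , b)
  ∘swap-injective σ σ-inj {i} {j} eq =
    transp-injective (σ-inj (trans (sym (lookup-∘swap σ i)) (trans eq (lookup-∘swap σ j))))

∘swap-≡⇒transp-≗ : ∀ {n} (σ : Vec (Fin n) n) {i j a b} → Injectiveᵥ σ →
                   σ ∘swap i , j ≡ σ ∘swap a , b → ∀ k → transp i j k ≡ transp a b k
∘swap-≡⇒transp-≗ σ {i} {j} {a} {b} σ-inj eq k = σ-inj (begin
  lookup σ (transp i j k)    ≡⟨ lookup-∘swap i j σ k ⟨
  lookup (σ ∘swap i , j) k   ≡⟨ cong (λ τ → lookup τ k) eq ⟩
  lookup (σ ∘swap a , b) k   ≡⟨ lookup-∘swap a b σ k ⟩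
  lookup σ (transp a b k)    ∎)
  where open ≡-Reasoning

data FriendlySwap {n : ℕ} (Z Y : Rel n) (σ : Vec (Fin n) n) : Vec (Fin n) n → Set where
  swap : ∀ {i j} → i ≢ j → T (Z i j) → T (Y (lookup σ i) (lookup σ j)) →
         FriendlySwap Z Y σ (σ ∘swap i , j)

dfsEdge-reflects : ∀ {n} (Z Y : Rel n) σ τ → T (dfsEdge Z Y σ τ) ⇔ FriendlySwap Z Y σ τ
dfsEdge-reflects {n} Z Y σ τ = mk⇔ sound (complete τ)
  where
  edge : Vec (Fin n) n → Fin n → Fin n → Bool
  edge τ i j = not (i == j) ∧ Z i j ∧ Y (lookup σ i) (lookup σ j) ∧ (τ =ᵥ (σ ∘swap i , j))

  sound : T (dfsEdge Z Y σ τ) → FriendlySwap Z Y σ τ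
  sound t with satisfied (any⁻ _ (allFin n) t)
  ... | i , tᵢ with satisfied (any⁻ (edge τ i) (allFin n) tᵢ)
  ... | j , tᵢⱼ with to (T-∧ {not (i == j)}) tᵢⱼ
  ... | i≢j , tᵢⱼ′ with to (T-∧ {Z i j}) tᵢⱼ′
  ... | Zij , tᵢⱼ″ with to (T-∧ {Y (lookup σ i) (lookup σ j)}) tᵢⱼ″
  ... | Yσiσj , τ≡σ∘ij with toWitness τ≡σ∘ij
  ... | refl = swap (toWitnessFalse i≢j) Zij Yσiσj

  complete : ∀ τ → FriendlySwap Z Y σ τ → T (dfsEdge Z Y σ τ)
  complete _ (swap {i} {j} i≢j Zij Yσiσj) =
    any⁺ _ (lose (∈-allFin i) (any⁺ (edge (σ ∘swap i , j) i) (lose (∈-allFin j) edge-ij)))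
    where
    edge-ij : T (edge (σ ∘swap i , j) i j)
    edge-ij = from (T-∧ {not (i == j)}) (fromWitnessFalse {a? = i ≟ j} i≢j ,
              from (T-∧ {Z i j}) (Zij , from (T-∧ {Y (lookup σ i) (lookup σ j)}) (Yσiσj ,
              fromWitness {a? = Vec.≡-dec _≟_ (σ ∘swap i , j) (σ ∘swap i , j)} refl)))

module _ {n : ℕ} (X : Rel n) (a b : Fin n) where

  deleteEdge-⊆ : ∀ {i j} → T (deleteEdge X a b i j) → T (X i j)
  deleteEdge-⊆ {i} {j} = proj₁ ∘ to (T-∧ {X i j})

  deleteEdge-removes : ¬ T (deleteEdge X a b a b)
  deleteEdge-removes t with a ≟ a | b ≟ b | proj₂ (to (T-∧ {X a b}) t)
  ... | yes _   | yes _   | ()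
  ... | no a≢a | _       | _ = a≢a refl
  ... | yes _   | no b≢b | _ = b≢b refl

  deleteEdge-keeps : ∀ {i j} → T (X i j) → ¬ (i ≡ a × j ≡ b) → T (deleteEdge X a b i j)
  deleteEdge-keeps {i} {j} Xij ¬ab with i ≟ a | j ≟ b
  ... | yes i≡a | yes j≡b = ⊥-elim (¬ab (i≡a , j≡b))
  ... | yes _   | no _    = from (T-∧ {X i j}) (Xij , _)
  ... | no _    | _       = from (T-∧ {X i j}) (Xij , _)

module _ {n : ℕ} {X : Rel n} (Y : Rel n) (X-digraph : IsDigraph X)
         {a b : Fin n} (Xab : X a b ≡ true) where

  open IsDigraph X-digraph

  private
    T-Xab : T (X a b)
    T-Xab = subst T (sym Xab) _

  friendlySwap-deleteEdge : ∀ {σ τ} → FriendlySwap X Y σ τ ⇔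
    ((T (Y (lookup σ a) (lookup σ b)) × τ ≡ σ ∘swap a , b) ⊎ FriendlySwap (deleteEdge X a b) Y σ τ)
  friendlySwap-deleteEdge = mk⇔ split merge
    where
    split : ∀ {σ τ} → FriendlySwap X Y σ τ →
            (T (Y (lookup σ a) (lookup σ b)) × τ ≡ σ ∘swap a , b) ⊎ FriendlySwap (deleteEdge X a b) Y σ τ
    split (swap {i} {j} i≢j Xij Yσiσj) with (i ≟ a) ×-dec (j ≟ b)
    ... | yes (refl , refl) = inj₁ (Yσiσj , refl)
    ... | no ¬ab            = inj₂ (swap i≢j (deleteEdge-keeps X a b Xij ¬ab) Yσiσj)

    a≢b : a ≢ b
    a≢b refl = subst T (loopless a) T-Xab

    merge : ∀ {σ τ} →
            (T (Y (lookup σ a) (lookup σ b)) × τ ≡ σ ∘swap a , b) ⊎ FriendlySwap (deleteEdge X a b) Y σ τ →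
            FriendlySwap X Y σ τ
    merge (inj₁ (Yσaσb , refl))        = swap a≢b T-Xab Yσaσb
    merge (inj₂ (swap i≢j X⁻ij Yσiσj)) = swap i≢j (deleteEdge-⊆ X a b X⁻ij) Yσiσj

  deleteEdge-swap-≢ : ∀ {σ τ} → Injectiveᵥ σ → FriendlySwap (deleteEdge X a b) Y σ τ → τ ≢ σ ∘swap a , b
  deleteEdge-swap-≢ {σ} σ-inj (swap {i} {j} i≢j X⁻ij _) eq =
    no-transposed-edge i≢j X⁻ij (trans (sym (transp-left i j)) (∘swap-≡⇒transp-≗ σ σ-inj eq i))
    where
    no-transposed-edge : ∀ {i j} → i ≢ j → T (deleteEdge X a b i j) → j ≢ transp a b i
    no-transposed-edge {i} i≢j X⁻ij j≡τi with transp-cases a b i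
    ... | inj₁ (refl , τa≡b) =
      deleteEdge-removes X a b (subst (T ∘ deleteEdge X a b a) (trans j≡τi τa≡b) X⁻ij)
    ... | inj₂ (inj₁ (refl , τb≡a)) =
      subst T (asymmetric a b Xab) (subst (T ∘ X b) (trans j≡τi τb≡a) (deleteEdge-⊆ X a b X⁻ij))
    ... | inj₂ (inj₂ τi≡i) = i≢j (sym (trans j≡τi τi≡i))

  outdeg-deleteEdge : ∀ σ → Injectiveᵥ σ →
    outdeg X Y σ ≡ (if Y (lookup σ a) (lookup σ b) then 1 else 0) Nat.+ outdeg (deleteEdge X a b) Y σ
  outdeg-deleteEdge σ σ-inj = begin
      outdeg X Y σ
    ≡⟨ count-cong dfsEdge-split (perms n) ⟩
      count (λ τ → ab-swap τ ∨ dfsEdge X⁻ Y σ τ) (perms n)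
    ≡⟨ count-∨ disjoint (perms n) ⟩
      count ab-swap (perms n) Nat.+ outdeg X⁻ Y σ
    ≡⟨ cong (Nat._+ outdeg X⁻ Y σ) (count-∧ˡ Yσaσb (perms n)) ⟩
      (if Yσaσb then count (_=ᵥ (σ ∘swap a , b)) (perms n) else 0) Nat.+ outdeg X⁻ Y σ
    ≡⟨ cong (λ k → (if Yσaσb then k else 0) Nat.+ outdeg X⁻ Y σ)
            (count-=ᵥ-perms (∘swap-injective a b σ σ-inj)) ⟩
      (if Yσaσb then 1 else 0) Nat.+ outdeg X⁻ Y σ
    ∎
    where
    open ≡-Reasoning
    X⁻ : Rel n
    X⁻ = deleteEdge X a b

    Yσaσb : Bool
    Yσaσb = Y (lookup σ a) (lookup σ b)

    ab-swap : Vec (Fin n) n → Bool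
    ab-swap τ = Yσaσb ∧ (τ =ᵥ (σ ∘swap a , b))

    ab-swap-reflects : ∀ {τ} → T (ab-swap τ) ⇔ (T Yσaσb × τ ≡ σ ∘swap a , b)
    ab-swap-reflects {τ} = mk⇔
      (λ t → let Yab , τ≡ = to (T-∧ {Yσaσb}) t in Yab , toWitness τ≡)
      (λ (Yab , τ≡) → from (T-∧ {Yσaσb}) (Yab , fromWitness τ≡))

    dfsEdge-split : ∀ τ → dfsEdge X Y σ τ ≡ ab-swap τ ∨ dfsEdge X⁻ Y σ τ
    dfsEdge-split τ = T-injective (mk⇔
      (from T-∨ ∘ Sum.map (from ab-swap-reflects) (from (dfsEdge-reflects X⁻ Y σ τ))
                ∘ to friendlySwap-deleteEdge ∘ to (dfsEdge-reflects X Y σ τ))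
      (from (dfsEdge-reflects X Y σ τ) ∘ from friendlySwap-deleteEdge
                ∘ Sum.map (to ab-swap-reflects) (to (dfsEdge-reflects X⁻ Y σ τ)) ∘ to (T-∨ {ab-swap τ})))

    disjoint : ∀ τ → T (ab-swap τ) → ¬ T (dfsEdge X⁻ Y σ τ)
    disjoint τ ab X⁻-edge =
      deleteEdge-swap-≢ σ-inj (to (dfsEdge-reflects X⁻ Y σ τ) X⁻-edge) (proj₂ (to ab-swap-reflects ab))

module _ {A : Set} where

  sumℚ-filterᵇ : ∀ (P : A → Bool) (g : A → ℚ) xs →
                 sumℚ (map g (filterᵇ P xs)) ≡ sumℚ (map (λ σ → if P σ then g σ else 0ℚ) xs)
  sumℚ-filterᵇ P g []       = refl
  sumℚ-filterᵇ P g (σ ∷ xs) with P σ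
  ... | true  = cong (g σ +_) (sumℚ-filterᵇ P g xs)
  ... | false = trans (sumℚ-filterᵇ P g xs) (sym (ℚ.+-identityˡ _))

  sumℚ-linear : ∀ (k : ℚ) (g h : A → ℚ) xs →
                sumℚ (map (λ σ → g σ - k * h σ) xs) ≡ sumℚ (map g xs) - k * sumℚ (map h xs)
  sumℚ-linear k g h []       = solve 1 (λ k → con 0ℚ := con 0ℚ :- k :* con 0ℚ) refl k
    where open +-*-Solver
  sumℚ-linear k g h (σ ∷ xs) = begin
      (g σ - k * h σ) + sumℚ (map (λ σ → g σ - k * h σ) xs)
    ≡⟨ cong ((g σ - k * h σ) +_) (sumℚ-linear k g h xs) ⟩
      (g σ - k * h σ) + (sumℚ (map g xs) - k * sumℚ (map h xs))
    ≡⟨ solve 5 (λ k g h G H → (g :- k :* h) :+ (G :- k :* H) := (g :+ G) :- k :* (h :+ H)) refl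
               k (g σ) (h σ) (sumℚ (map g xs)) (sumℚ (map h xs)) ⟩
      (g σ + sumℚ (map g xs)) - k * (h σ + sumℚ (map h xs))
    ∎
    where open ≡-Reasoning
          open +-*-Solver

module _ (x : ℚ) .{{_ : NonZero x}} where

  ^-lower : ∀ d → x ^ d ≡ x ^ suc d - ((x - 1ℚ) * 1/ x) * x ^ suc d
  ^-lower d = begin
      x ^ d
    ≡⟨ solve 2 (λ x u → u := x :* u :- (x :- con 1ℚ) :* con 1ℚ :* u) refl x (x ^ d) ⟩
      x * x ^ d - (x - 1ℚ) * 1ℚ * x ^ d
    ≡⟨ cong (λ e → x * x ^ d - (x - 1ℚ) * e * x ^ d) (ℚ.*-inverseˡ x) ⟨
      x * x ^ d - (x - 1ℚ) * (1/ x * x) * x ^ d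
    ≡⟨ solve 3 (λ x y u → x :* u :- (x :- con 1ℚ) :* (y :* x) :* u
                       := x :* u :- ((x :- con 1ℚ) :* y) :* (x :* u)) refl x (1/ x) (x ^ d) ⟩
      x * x ^ d - ((x - 1ℚ) * 1/ x) * (x * x ^ d)
    ∎
    where open ≡-Reasoning
          open +-*-Solver

  ^-lower-if : ∀ (c : Bool) d → let e = (if c then 1 else 0) Nat.+ d in
              x ^ d ≡ x ^ e - ((x - 1ℚ) * 1/ x) * (if c then x ^ e else 0ℚ)
  ^-lower-if true  d = ^-lower d
  ^-lower-if false d = solve 2 (λ u k → u := u :- k :* con 0ℚ) refl (x ^ d) ((x - 1ℚ) * 1/ x)
    where open +-*-Solver

theorem4p1 : (n : ℕ) (X Y : Rel n) → IsDigraph X → IsDigraph Y →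
    (a b : Fin n) → X a b ≡ true →
    (x : ℚ) .{{_ : NonZero x}} →
    ODP (deleteEdge X a b) Y x
      ≡ ODP X Y x - ((x - 1ℚ) * (1/ x)) * ODP[ a ⟶ b ] X Y x
theorem4p1 n X Y X-digraph _ a b Xab x = begin
    ODP (deleteEdge X a b) Y x
  ≡⟨ cong sumℚ (map-cong-local (All.tabulate lower-ab)) ⟩
    sumℚ (map (λ σ → x ^ outdeg X Y σ - k * (if Yab σ then x ^ outdeg X Y σ else 0ℚ)) (perms n))
  ≡⟨ sumℚ-linear k (λ σ → x ^ outdeg X Y σ) (λ σ → if Yab σ then x ^ outdeg X Y σ else 0ℚ) (perms n) ⟩
    ODP X Y x - k * sumℚ (map (λ σ → if Yab σ then x ^ outdeg X Y σ else 0ℚ) (perms n))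
  ≡⟨ cong (λ s → ODP X Y x - k * s) (sumℚ-filterᵇ Yab (λ σ → x ^ outdeg X Y σ) (perms n)) ⟨
    ODP X Y x - k * ODP[ a ⟶ b ] X Y x
  ∎
  where
  open ≡-Reasoning

  k : ℚ
  k = (x - 1ℚ) * 1/ x

  Yab : Vec (Fin n) n → Bool
  Yab σ = Y (lookup σ a) (lookup σ b)

  lower-ab : ∀ {σ} → σ ∈ perms n → x ^ outdeg (deleteEdge X a b) Y σ
             ≡ x ^ outdeg X Y σ - k * (if Yab σ then x ^ outdeg X Y σ else 0ℚ)
  lower-ab {σ} σ∈ =
    subst (λ e → x ^ outdeg (deleteEdge X a b) Y σ ≡ x ^ e - k * (if Yab σ then x ^ e else 0ℚ))
          (sym (outdeg-deleteEdge Y X-digraph Xab σ (∈-perms⁻ σ∈)))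
          (^-lower-if x (Yab σ) (outdeg (deleteEdge X a b) Y σ))
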